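{- Let $\phi\mapsto\phi^{\oplus}$ be any positivation operator on $\mathsf{MIL}$ formulae, and let $\phi_1,\phi_2$ be $\mathsf{MIL}$ formulae. Then: (1) $(\phi_1\vee\phi_2)^{\oplus}\equiv^\mu\phi_1^{\oplus}\vee\phi_2^{\oplus}$; (2) $(\phi_1\wedge\phi_2)^{\oplus}\equiv^\mu\phi_1^{\oplus}\wedge\phi_2^{\oplus}$, provided that $\mathrm{voc}(\phi_1)\cap\mathrm{voc}(\phi_2)=\emptyset$.
   Context: $\mathsf{MIL}$: unary predicate symbols $\mathsf{Pred}=\bigcup_k\mathsf{Pred}_k$ and typed index variables $\mathsf{Var}=\bigcup_k\mathsf{Var}_k$ ($k\in[1,n]$, disjoint); formulae $\phi::=i=j\mid\mathsf{pred}(i)\mid\phi\wedge\phi\mid\neg\phi\mid\exists i.\phi$ ($\mathsf{pred}\in\mathsf{Pred}_k$ applied only to $i\in\mathsf{Var}_k$), usual abbreviations. Given $\mathsf{M}:[1,n]\to\mathbb{N}$, structures $\mathcal{I}=(\mathfrak{U},\nu,\iota)$ with $\mathfrak{U}=[1,\max_k\mathsf{M}(k)]$, $\nu:\mathsf{Var}\to\mathfrak{U}$, $\iota:\mathsf{Pred}\to2^\mathfrak{U}$, standard semantics with $\exists i$, $i\in\mathsf{Var}_k$, ranging over $[1,\mathsf{M}(k)]$. $\mathcal{I}_1\subseteq\mathcal{I}_2$ iff $\iota_1(p)\subseteq\iota_2(p)$ for all $p$; minimal models of $\phi$ are models $\mathcal{I}$ with no model $\mathcal{I}'\subseteq\mathcal{I}$,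 $\mathcal{I}'\ne\mathcal{I}$; $\phi_1\equiv^\mu\phi_2$ iff they have the same minimal models. A formula is positive if each predicate symbol occurs under an even number of negations. A positivation operator maps each $\mathsf{MIL}$ formula $\phi$ to a positive $\mathsf{MIL}$ formula $\phi^{\oplus}$ with $\phi\equiv^\mu\phi^{\oplus}$. $\mathrm{voc}(\phi)$ is the set of predicate symbols occurring in $\phi$. -}

module Defs where

open import Data.Nat using (ℕ; zero; suc; _<_; _⊔_)
open import Data.Fin using (Fin; toℕ)
import Data.Fin
open import Data.Bool using (Bool; true)
open import Data.Product using (Σ; _×_; _,_)
open import Data.Unit using (⊤)
open import Data.Empty using (⊥)
open import Relation.Nullary using (¬_; yes; no)
open import Relation.Binary.PropositionalEquality using (_≡_)
import Data.Fin.Properties as FinP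
import Data.Nat.Properties as NatP
open import Data.Product.Properties using (≡-dec)

-- Signature with n sorts (k ∈ [1,n] rendered as Fin n).
-- Pred_k = { k } × ℕ and Var_k = { k } × ℕ: countably many predicate
-- symbols / index variables of every sort, the sorts being disjoint.

Pred : ℕ → Set
Pred n = Fin n × ℕ

Var : ℕ → Set
Var n = Fin n × ℕ

sort : ∀ {n} → Var n → Fin n
sort (k , _) = k

_≟ᵥ_ : ∀ {n} (x y : Var n) → Relation.Nullary.Dec (x ≡ y)
_≟ᵥ_ = ≡-dec FinP._≟_ NatP._≟_

-- MIL formulae.  `atom k p i` is pred(i) with pred = (k , p) ∈ Pred_k
-- and i = (k , i) ∈ Var_k (so predicates of sort k only apply to
-- variables of sort k).

data Formula (n : ℕ) : Set where
  _≐_  : Var n → Var n → Formula n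
  atom : (k : Fin n) → (p i : ℕ) → Formula n
  _∧_  : Formula n → Formula n → Formula n
  ¬'_  : Formula n → Formula n
  ∃'   : Var n → Formula n → Formula n

_∨_ : ∀ {n} → Formula n → Formula n → Formula n
φ ∨ ψ = ¬' ((¬' φ) ∧ (¬' ψ))

mutual
  PosOcc : ∀ {n} → Formula n → Set
  PosOcc (i ≐ j)    = ⊤
  PosOcc (atom k p i) = ⊤
  PosOcc (φ ∧ ψ)    = PosOcc φ × PosOcc ψ
  PosOcc (¬' φ)     = NegOcc φ
  PosOcc (∃' i φ)   = PosOcc φ

  NegOcc : ∀ {n} → Formula n → Set
  NegOcc (i ≐ j)    = ⊤
  NegOcc (atom k p i) = ⊥
  NegOcc (φ ∧ ψ)    = NegOcc φ × NegOcc ψ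
  NegOcc (¬' φ)     = PosOcc φ
  NegOcc (∃' i φ)   = NegOcc φ

Positive : ∀ {n} → Formula n → Set
Positive = PosOcc

data _∈voc_ {n : ℕ} : Pred n → Formula n → Set where
  here  : ∀ {k p i} → (k , p) ∈voc atom k p i
  ∧ˡ    : ∀ {q φ ψ} → q ∈voc φ → q ∈voc (φ ∧ ψ)
  ∧ʳ    : ∀ {q φ ψ} → q ∈voc ψ → q ∈voc (φ ∧ ψ)
  ¬in   : ∀ {q φ} → q ∈voc φ → q ∈voc (¬' φ)
  ∃in   : ∀ {q i φ} → q ∈voc φ → q ∈voc (∃' i φ)

DisjointVoc : ∀ {n} → Formula n → Formula n → Set
DisjointVoc φ ψ = ∀ q → q ∈voc φ → q ∈voc ψ → ⊥

-- Semantics.  M : [1,n] → ℕ ; universe U = [1, max_k M(k)], rendered as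
-- Fin (maxM M) (the element x : Fin m stands for toℕ x + 1).

maxM : ∀ {n} → (Fin n → ℕ) → ℕ
maxM {zero}  M = 0
maxM {suc n} M = M Data.Fin.zero ⊔ maxM {n} (λ k → M (Data.Fin.suc k))

record Structure {n : ℕ} (M : Fin n → ℕ) : Set where
  constructor ⟨_,_⟩
  field
    ν : Var n → Fin (maxM M)
    ι : Pred n → Fin (maxM M) → Bool
open Structure public

_[_↦_] : ∀ {n} {M : Fin n → ℕ} → Structure M → Var n → Fin (maxM M) → Structure M
_[_↦_] I x u = ⟨ (λ y → upd (y ≟ᵥ x)) , ι I ⟩
  where
  upd : ∀ {y} → Relation.Nullary.Dec (y ≡ x) → Fin _
  upd {y} (yes _) = u
  upd {y} (no _)  = ν I y

-- satisfaction; ∃ i with i ∈ Var_k ranges over [1, M(k)]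
_⊨_ : ∀ {n} {M : Fin n → ℕ} → Structure M → Formula n → Set
I ⊨ (i ≐ j)      = ν I i ≡ ν I j
I ⊨ atom k p i   = ι I (k , p) (ν I (k , i)) ≡ true
I ⊨ (φ ∧ ψ)      = (I ⊨ φ) × (I ⊨ ψ)
_⊨_ {M = M} I (¬' φ) = ¬ (I ⊨ φ)
_⊨_ {M = M} I (∃' i φ) = Σ (Fin (maxM M)) λ u → (toℕ u < M (sort i)) × ((I [ i ↦ u ]) ⊨ φ)

_⊆_ : ∀ {n} {M : Fin n → ℕ} → Structure M → Structure M → Set
I₁ ⊆ I₂ = (∀ x → ν I₁ x ≡ ν I₂ x) × (∀ p u → ι I₁ p u ≡ true → ι I₂ p u ≡ true)

_≈_ : ∀ {n} {M : Fin n → ℕ} → Structure M → Structure M → Set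
I₁ ≈ I₂ = (∀ x → ν I₁ x ≡ ν I₂ x) × (∀ p u → ι I₁ p u ≡ ι I₂ p u)

MinModel : ∀ {n} (M : Fin n → ℕ) → Formula n → Structure M → Set
MinModel M φ I = (I ⊨ φ) × ¬ (Σ (Structure M) λ I' → (I' ⊆ I) × (I' ⊨ φ) × ¬ (I' ≈ I))

_≡μ[_]_ : ∀ {n} → Formula n → (M : Fin n → ℕ) → Formula n → Set
φ ≡μ[ M ] ψ = ∀ (I : Structure M) → (MinModel M φ I → MinModel M ψ I) × (MinModel M ψ I → MinModel M φ I)

record Positivation {n : ℕ} (M : Fin n → ℕ) : Set where
  field
    _⊕        : Formula n → Formula n
    positive  : ∀ φ → Positive (φ ⊕)
    equiv     : ∀ φ → φ ≡μ[ M ] (φ ⊕)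

-- Let  Above φ I  say that (classically) some minimal model of φ lies below I.
-- Key fact: if ψ is positive and φ ≡μ ψ, the models of ψ are exactly the
-- structures above a minimal model of φ.  It combines three lemmas: every
-- model lies above a minimal one (descent on the number of true atoms over
-- voc(φ)); positive formulae are upward closed; satisfaction is decidable.
-- So the models of φ⊕ are determined by  Above φ,  and we compute  Above  on
-- compound formulae: it distributes over ∨, and over ∧ when the vocabularies
-- are disjoint (merge a model of φ₁ and one of φ₂ into a model of φ₁ ∧ φ₂).
-- Formulae with the same models have the same minimal models, which gives
-- both parts.  Existence statements live in the double-negation monad, as
-- minimality is not decidable.

module Submission where

open import Defs
open import Data.Nat using (ℕ; zero; suc; _+_; _≤_; _<_; z≤n; _<?_)
open import Data.Nat.Properties
  using (≤-refl; ≤-trans; ≤-antisym; ≤-reflexive; +-mono-≤; +-monoˡ-≤; +-monoʳ-≤; +-cancelˡ-≤; +-cancelʳ-≤; ≤∧≢⇒<)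
open import Data.Nat.Induction using (<-wellFounded)
open import Data.Fin using (Fin; toℕ)
import Data.Fin as Fin
open import Data.Fin.Properties using (any?)
open import Data.Bool using (Bool; true; false; if_then_else_)
import Data.Bool as Bool
open import Data.Product using (Σ; _×_; _,_; proj₁; proj₂)
open import Data.Empty using (⊥-elim)
open import Function.Bundles using (_⇔_; mk⇔; Equivalence)
open import Induction.WellFounded using (Acc; acc)
open import Relation.Nullary using (¬_; Dec; yes; no)
open import Relation.Nullary.Decidable using (_×-dec_; ¬?; decidable-stable; ¬¬-excluded-middle)
open import Relation.Nullary.Negation using (¬¬-Monad; ¬¬-map)
open import Relation.Binary.PropositionalEquality using (_≡_; refl; sym; trans; subst)
open import Effect.Monad using (RawMonad)
open import Level using (0ℓ)

open RawMonad (¬¬-Monad {a = 0ℓ}) using (pure; _>>=_)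
open Equivalence using (to; from)

Included : ∀ {m} → (Fin m → Bool) → (Fin m → Bool) → Set
Included f g = ∀ u → f u ≡ true → g u ≡ true

count : ∀ {m} → (Fin m → Bool) → ℕ
count {zero}  f = 0
count {suc m} f = (if f Fin.zero then 1 else 0) + count (λ u → f (Fin.suc u))

sum-parts-equal : ∀ {a a' b b'} → a ≤ a' → b ≤ b' → a + b ≡ a' + b' → (a ≡ a') × (b ≡ b')
sum-parts-equal {a} {a'} {b} {b'} a≤a' b≤b' eq =
  ≤-antisym a≤a' (+-cancelʳ-≤ b a' a (≤-trans (+-monoʳ-≤ a' b≤b') (≤-reflexive (sym eq)))) ,
  ≤-antisym b≤b' (+-cancelˡ-≤ a b' b (≤-trans (+-monoˡ-≤ b' a≤a') (≤-reflexive (sym eq))))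

bit-mono : ∀ a b → (a ≡ true → b ≡ true) → (if a then 1 else 0) ≤ (if b then 1 else 0)
bit-mono true  b imp with imp refl
... | refl = ≤-refl
bit-mono false b imp = z≤n

bit-reflects : ∀ a b → (if a then 1 else 0) ≡ (if b then 1 else 0) → a ≡ b
bit-reflects true  true  _ = refl
bit-reflects false false _ = refl
bit-reflects true  false ()
bit-reflects false true  ()

count-mono : ∀ {m} (f g : Fin m → Bool) → Included f g → count f ≤ count g
count-mono {zero}  f g f⊆g = z≤n
count-mono {suc m} f g f⊆g =
  +-mono-≤ (bit-mono _ _ (f⊆g Fin.zero)) (count-mono _ _ (λ u → f⊆g (Fin.suc u)))

count-reflects : ∀ {m} (f g : Fin m → Bool) → Included f g → count f ≡ count g → ∀ u → f u ≡ g u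
count-reflects {suc m} f g f⊆g eq u
  with sum-parts-equal (bit-mono _ _ (f⊆g Fin.zero)) (count-mono _ _ (λ v → f⊆g (Fin.suc v))) eq
count-reflects {suc m} f g f⊆g eq Fin.zero    | head-eq , _ = bit-reflects _ _ head-eq
count-reflects {suc m} f g f⊆g eq (Fin.suc u) | _ , tail-eq =
  count-reflects _ _ (λ v → f⊆g (Fin.suc v)) tail-eq u

module _ {n : ℕ} {M : Fin n → ℕ} where

  ⊆-refl : {I : Structure M} → I ⊆ I
  ⊆-refl = (λ _ → refl) , (λ _ _ h → h)

  ⊆-trans : {I J K : Structure M} → I ⊆ J → J ⊆ K → I ⊆ K
  ⊆-trans (ν₁ , ι₁) (ν₂ , ι₂) = (λ x → trans (ν₁ x) (ν₂ x)) , (λ p u h → ι₂ p u (ι₁ p u h))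

  update-agrees : ∀ (I J : Structure M) x u → (∀ y → ν I y ≡ ν J y) →
                  ∀ y → ν (I [ x ↦ u ]) y ≡ ν (J [ x ↦ u ]) y
  update-agrees I J x u agree y with y ≟ᵥ x
  ... | yes _ = refl
  ... | no  _ = agree y

  -- Satisfaction is decidable: quantifiers range over a finite universe.
  ⊨-dec : ∀ φ (I : Structure M) → Dec (I ⊨ φ)
  ⊨-dec (i ≐ j)      I = ν I i Fin.≟ ν I j
  ⊨-dec (atom k p i) I = ι I (k , p) (ν I (k , i)) Bool.≟ true
  ⊨-dec (φ ∧ ψ)      I = ⊨-dec φ I ×-dec ⊨-dec ψ I
  ⊨-dec (¬' φ)       I = ¬? (⊨-dec φ I)
  ⊨-dec (∃' i φ)     I = any? (λ u → (toℕ u <? M (sort i)) ×-dec ⊨-dec φ (I [ i ↦ u ]))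

  mutual
    monotone : ∀ φ → PosOcc φ → {I J : Structure M} → I ⊆ J → I ⊨ φ → J ⊨ φ
    monotone (i ≐ j)      _ (ν≡ , _)    h = trans (sym (ν≡ i)) (trans h (ν≡ j))
    monotone (atom k p i) _ {I} (ν≡ , ι⊆) h = ι⊆ (k , p) _ (subst (λ v → ι I (k , p) v ≡ true) (ν≡ (k , i)) h)
    monotone (φ ∧ ψ) (pφ , pψ) I⊆J (hφ , hψ) = monotone φ pφ I⊆J hφ , monotone ψ pψ I⊆J hψ
    monotone (¬' φ)       nφ I⊆J        h = λ hJ → h (antitone φ nφ I⊆J hJ)
    monotone (∃' i φ) pφ {I} {J} (ν≡ , ι⊆) (u , u<M , h) =
      u , u<M , monotone φ pφ (update-agrees I J i u ν≡ , ι⊆) h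

    antitone : ∀ φ → NegOcc φ → {I J : Structure M} → I ⊆ J → J ⊨ φ → I ⊨ φ
    antitone (i ≐ j)      _ (ν≡ , _)    h = trans (ν≡ i) (trans h (sym (ν≡ j)))
    antitone (atom k p i) () _ _
    antitone (φ ∧ ψ) (nφ , nψ) I⊆J (hφ , hψ) = antitone φ nφ I⊆J hφ , antitone ψ nψ I⊆J hψ
    antitone (¬' φ)       pφ I⊆J        h = λ hI → h (monotone φ pφ I⊆J hI)
    antitone (∃' i φ) nφ {I} {J} (ν≡ , ι⊆) (u , u<M , h) =
      u , u<M , antitone φ nφ (update-agrees I J i u ν≡ , ι⊆) h

  AgreeOn : Formula n → Structure M → Structure M → Set
  AgreeOn φ I J = (∀ x → ν I x ≡ ν J x) × (∀ q → q ∈voc φ → ∀ u → ι I q u ≡ ι J q u)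

  coincidence : ∀ φ {I J : Structure M} → AgreeOn φ I J → I ⊨ φ → J ⊨ φ
  coincidence (i ≐ j)      (ν≡ , _) h = trans (sym (ν≡ i)) (trans h (ν≡ j))
  coincidence (atom k p i) {I} (ν≡ , ι≡) h =
    trans (sym (ι≡ (k , p) here _)) (subst (λ v → ι I (k , p) v ≡ true) (ν≡ (k , i)) h)
  coincidence (φ ∧ ψ) (ν≡ , ι≡) (hφ , hψ) =
    coincidence φ (ν≡ , λ q v → ι≡ q (∧ˡ v)) hφ , coincidence ψ (ν≡ , λ q v → ι≡ q (∧ʳ v)) hψ
  coincidence (¬' φ) (ν≡ , ι≡) h =
    λ hJ → h (coincidence φ ((λ x → sym (ν≡ x)) , λ q v u → sym (ι≡ q (¬in v) u)) hJ)
  coincidence (∃' i φ) {I} {J} (ν≡ , ι≡) (u , u<M , h) =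
    u , u<M , coincidence φ (update-agrees I J i u ν≡ , λ q v → ι≡ q (∃in v)) h

  ∈voc? : ∀ (q : Pred n) φ → Dec (q ∈voc φ)
  ∈voc? q (i ≐ j) = no (λ ())
  ∈voc? q (atom k p i) with q ≟ᵥ (k , p)
  ... | yes refl = yes here
  ... | no  q≢   = no (λ { here → q≢ refl })
  ∈voc? q (φ ∧ ψ) with ∈voc? q φ | ∈voc? q ψ
  ... | yes inφ | _       = yes (∧ˡ inφ)
  ... | no  _   | yes inψ = yes (∧ʳ inψ)
  ... | no  ∉φ  | no  ∉ψ  = no (λ { (∧ˡ inφ) → ∉φ inφ ; (∧ʳ inψ) → ∉ψ inψ })
  ∈voc? q (¬' φ) with ∈voc? q φ
  ... | yes inφ = yes (¬in inφ)
  ... | no  ∉φ  = no (λ { (¬in inφ) → ∉φ inφ })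
  ∈voc? q (∃' i φ) with ∈voc? q φ
  ... | yes inφ = yes (∃in inφ)
  ... | no  ∉φ  = no (λ { (∃in inφ) → ∉φ inφ })

  splice : Formula n → (Pred n → Fin (maxM M) → Bool) → (Pred n → Fin (maxM M) → Bool) →
           Pred n → Fin (maxM M) → Bool
  splice φ f g q with ∈voc? q φ
  ... | yes _ = f q
  ... | no  _ = g q

  splice-inside : ∀ φ f g q → q ∈voc φ → ∀ u → splice φ f g q u ≡ f q u
  splice-inside φ f g q inφ u with ∈voc? q φ
  ... | yes _ = refl
  ... | no ∉φ = ⊥-elim (∉φ inφ)

  splice-outside : ∀ φ f g q → ¬ q ∈voc φ → ∀ u → splice φ f g q u ≡ g q u
  splice-outside φ f g q ∉φ u with ∈voc? q φ
  ... | yes inφ = ⊥-elim (∉φ inφ)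
  ... | no  _   = refl

  splice-below : ∀ φ (I J₁ J₂ : Structure M) → J₁ ⊆ I → J₂ ⊆ I →
                 ⟨ ν I , splice φ (ι J₁) (ι J₂) ⟩ ⊆ I
  splice-below φ I J₁ J₂ (_ , ι₁⊆) (_ , ι₂⊆) = (λ _ → refl) , included
    where
    included : ∀ q u → splice φ (ι J₁) (ι J₂) q u ≡ true → ι I q u ≡ true
    included q u h with ∈voc? q φ
    ... | yes _ = ι₁⊆ q u h
    ... | no  _ = ι₂⊆ q u h

  weight : ∀ {m} → Formula n → (Pred n → Fin m → Bool) → ℕ
  weight (i ≐ j)      f = 0
  weight (atom k p i) f = count (f (k , p))
  weight (φ ∧ ψ)      f = weight φ f + weight ψ f
  weight (¬' φ)       f = weight φ f
  weight (∃' i φ)     f = weight φ f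

  weight-mono : ∀ {m} φ (f g : Pred n → Fin m → Bool) → (∀ q → Included (f q) (g q)) →
                weight φ f ≤ weight φ g
  weight-mono (i ≐ j)      f g f⊆g = z≤n
  weight-mono (atom k p i) f g f⊆g = count-mono _ _ (f⊆g (k , p))
  weight-mono (φ ∧ ψ)      f g f⊆g = +-mono-≤ (weight-mono φ f g f⊆g) (weight-mono ψ f g f⊆g)
  weight-mono (¬' φ)       f g f⊆g = weight-mono φ f g f⊆g
  weight-mono (∃' i φ)     f g f⊆g = weight-mono φ f g f⊆g

  weight-reflects : ∀ {m} φ (f g : Pred n → Fin m → Bool) → (∀ q → Included (f q) (g q)) →
                    weight φ f ≡ weight φ g → ∀ q → q ∈voc φ → ∀ u → f q u ≡ g q u
  weight-reflects (atom k p i) f g f⊆g eq .(k , p) here = count-reflects _ _ (f⊆g (k , p)) eq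
  weight-reflects (φ ∧ ψ) f g f⊆g eq q (∧ˡ inφ) =
    weight-reflects φ f g f⊆g (proj₁ (sum-parts-equal (weight-mono φ f g f⊆g) (weight-mono ψ f g f⊆g) eq)) q inφ
  weight-reflects (φ ∧ ψ) f g f⊆g eq q (∧ʳ inψ) =
    weight-reflects ψ f g f⊆g (proj₂ (sum-parts-equal (weight-mono φ f g f⊆g) (weight-mono ψ f g f⊆g) eq)) q inψ
  weight-reflects (¬' φ)   f g f⊆g eq q (¬in inφ) = weight-reflects φ f g f⊆g eq q inφ
  weight-reflects (∃' i φ) f g f⊆g eq q (∃in inφ) = weight-reflects φ f g f⊆g eq q inφ

  Restricted : Formula n → Structure M → Set
  Restricted φ I = ∀ q → ¬ q ∈voc φ → ∀ u → ι I q u ≡ false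

  restricted-⊆ : ∀ φ {I J : Structure M} → Restricted φ J → I ⊆ J → Restricted φ I
  restricted-⊆ φ {I} restr (_ , ι⊆) q ∉φ u with ι I q u in eq
  ... | false = refl
  ... | true with trans (sym (restr q ∉φ u)) (ι⊆ q u eq)
  ... | ()

  weight-strict : ∀ φ {I J : Structure M} → Restricted φ J → I ⊆ J → ¬ I ≈ J →
                  weight φ (ι I) < weight φ (ι J)
  weight-strict φ {I} {J} restr I⊆J@(ν≡ , ι⊆) I≉J =
    ≤∧≢⇒< (weight-mono φ (ι I) (ι J) ι⊆) (λ eq → I≉J (ν≡ , same-ι eq))
    where
    same-ι : weight φ (ι I) ≡ weight φ (ι J) → ∀ q u → ι I q u ≡ ι J q u
    same-ι eq q u with ∈voc? q φ
    ... | yes inφ = weight-reflects φ (ι I) (ι J) ι⊆ eq q inφ u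
    ... | no  ∉φ  = trans (restricted-⊆ φ restr I⊆J q ∉φ u) (sym (restr q ∉φ u))

  Below : Formula n → Structure M → Set
  Below φ I = Σ (Structure M) λ J → (J ⊆ I) × MinModel M φ J

  Above : Formula n → Structure M → Set
  Above φ I = ¬ ¬ Below φ I

  above-⊆ : ∀ φ {I J : Structure M} → I ⊆ J → Above φ I → Above φ J
  above-⊆ φ I⊆J = ¬¬-map λ (K , K⊆I , min) → K , ⊆-trans K⊆I I⊆J , min

  -- Descent: a restricted model is minimal or has a proper submodel, which
  -- is again restricted and of smaller weight.
  descend : ∀ φ (I : Structure M) → Acc _<_ (weight φ (ι I)) → Restricted φ I → I ⊨ φ → Above φ I
  descend φ I (acc smaller) restr sat = ¬¬-excluded-middle >>= λ where
    (no no-submodel) → pure (I , ⊆-refl , sat , no-submodel)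
    (yes (I' , I'⊆I , sat' , I'≉I)) →
      above-⊆ φ I'⊆I
        (descend φ I' (smaller (weight-strict φ restr I'⊆I I'≉I)) (restricted-⊆ φ restr I'⊆I) sat')

  minimal-below : ∀ φ {I : Structure M} → I ⊨ φ → Above φ I
  minimal-below φ {I} sat =
    above-⊆ φ (splice-below φ I I I₀ ⊆-refl ((λ _ → refl) , λ _ _ ()))
      (descend φ I↾φ (<-wellFounded _) restricted (coincidence φ agree sat))
    where
    I₀ I↾φ : Structure M
    I₀  = ⟨ ν I , (λ _ _ → false) ⟩
    I↾φ = ⟨ ν I , splice φ (ι I) (ι I₀) ⟩
    restricted : Restricted φ I↾φ
    restricted q ∉φ = splice-outside φ (ι I) (ι I₀) q ∉φ
    agree : AgreeOn φ I I↾φ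
    agree = (λ _ → refl) , λ q inφ u → sym (splice-inside φ (ι I) (ι I₀) q inφ u)

  above-weaken : ∀ χ ψ → (∀ (J : Structure M) → J ⊨ χ → J ⊨ ψ) → {I : Structure M} → Above χ I → Above ψ I
  above-weaken χ ψ χ⇒ψ above = do
    (J , J⊆I , satJ , _) ← above
    above-⊆ ψ J⊆I (minimal-below ψ (χ⇒ψ J satJ))

  positive-upward-closure : ∀ φ ψ → Positive ψ → φ ≡μ[ M ] ψ → (I : Structure M) → (I ⊨ ψ) ⇔ Above φ I
  positive-upward-closure φ ψ pos φ≡ψ I = mk⇔
    (λ sat → do
      (J , J⊆I , minψ) ← minimal-below ψ sat
      pure (J , J⊆I , proj₂ (φ≡ψ J) minψ))
    (λ above → decidable-stable (⊨-dec ψ I) (do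
      (J , J⊆I , minφ) ← above
      pure (monotone ψ pos J⊆I (proj₁ (proj₁ (φ≡ψ J) minφ)))))

  same-models-≡μ : ∀ χ ψ → (∀ (I : Structure M) → (I ⊨ χ) ⇔ (I ⊨ ψ)) → χ ≡μ[ M ] ψ
  same-models-≡μ χ ψ iff I =
    (λ (sat , no-sub) → to (iff I) sat , λ (I' , I'⊆I , sat' , I'≉I) → no-sub (I' , I'⊆I , from (iff I') sat' , I'≉I)) ,
    (λ (sat , no-sub) → from (iff I) sat , λ (I' , I'⊆I , sat' , I'≉I) → no-sub (I' , I'⊆I , to (iff I') sat' , I'≉I))

  minimal-strengthen : ∀ χ ψ → (∀ (J : Structure M) → J ⊨ χ → J ⊨ ψ) →
                       {J : Structure M} → MinModel M ψ J → J ⊨ χ → MinModel M χ J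
  minimal-strengthen χ ψ χ⇒ψ (_ , no-sub) satχ =
    satχ , λ (I' , I'⊆J , sat' , I'≉J) → no-sub (I' , I'⊆J , χ⇒ψ I' sat' , I'≉J)

  above-∨ : ∀ φ₁ φ₂ (I : Structure M) → Above (φ₁ ∨ φ₂) I ⇔ (¬ (¬ Above φ₁ I × ¬ Above φ₂ I))
  above-∨ φ₁ φ₂ I = mk⇔
    (λ above (¬above₁ , ¬above₂) → above λ (J , J⊆I , min) →
      proj₁ min ( (λ sat₁ → ¬above₁ (pure (J , J⊆I , minimal-strengthen φ₁ (φ₁ ∨ φ₂) (λ _ s (¬s , _) → ¬s s) min sat₁)))
                , (λ sat₂ → ¬above₂ (pure (J , J⊆I , minimal-strengthen φ₂ (φ₁ ∨ φ₂) (λ _ s (_ , ¬s) → ¬s s) min sat₂)))))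
    (λ either ¬above → either
      ( (λ above₁ → above-weaken φ₁ (φ₁ ∨ φ₂) (λ _ s (¬s , _) → ¬s s) above₁ ¬above)
      , (λ above₂ → above-weaken φ₂ (φ₁ ∨ φ₂) (λ _ s (_ , ¬s) → ¬s s) above₂ ¬above)))

  merge : ∀ φ₁ φ₂ → DisjointVoc φ₁ φ₂ → {I J₁ J₂ : Structure M} → J₁ ⊆ I → J₂ ⊆ I →
          J₁ ⊨ φ₁ → J₂ ⊨ φ₂ → Σ (Structure M) λ K → (K ⊆ I) × (K ⊨ (φ₁ ∧ φ₂))
  merge φ₁ φ₂ disjoint {I} {J₁} {J₂} J₁⊆I J₂⊆I sat₁ sat₂ =
    K , splice-below φ₁ I J₁ J₂ J₁⊆I J₂⊆I ,
    coincidence φ₁ (proj₁ J₁⊆I , λ q in₁ u → sym (splice-inside φ₁ (ι J₁) (ι J₂) q in₁ u)) sat₁ ,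
    coincidence φ₂ (proj₁ J₂⊆I , λ q in₂ u → sym (splice-outside φ₁ (ι J₁) (ι J₂) q (λ in₁ → disjoint q in₁ in₂) u)) sat₂
    where
    K : Structure M
    K = ⟨ ν I , splice φ₁ (ι J₁) (ι J₂) ⟩

  above-∧ : ∀ φ₁ φ₂ → DisjointVoc φ₁ φ₂ → (I : Structure M) → Above (φ₁ ∧ φ₂) I ⇔ (Above φ₁ I × Above φ₂ I)
  above-∧ φ₁ φ₂ disjoint I = mk⇔
    (λ above → above-weaken (φ₁ ∧ φ₂) φ₁ (λ _ → proj₁) above , above-weaken (φ₁ ∧ φ₂) φ₂ (λ _ → proj₂) above)
    (λ (above₁ , above₂) → do
      (J₁ , J₁⊆I , sat₁ , _) ← above₁
      (J₂ , J₂⊆I , sat₂ , _) ← above₂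
      let (K , K⊆I , satK) = merge φ₁ φ₂ disjoint J₁⊆I J₂⊆I sat₁ sat₂
      above-⊆ (φ₁ ∧ φ₂) K⊆I (minimal-below (φ₁ ∧ φ₂) satK))

proposition1 : ∀ (n : ℕ) (M : Fin n → ℕ) (P : Positivation M) (φ₁ φ₂ : Formula n) →
    let open Positivation P in
    (((φ₁ ∨ φ₂) ⊕) ≡μ[ M ] ((φ₁ ⊕) ∨ (φ₂ ⊕)))
    × (DisjointVoc φ₁ φ₂ → ((φ₁ ∧ φ₂) ⊕) ≡μ[ M ] ((φ₁ ⊕) ∧ (φ₂ ⊕)))
proposition1 n M P φ₁ φ₂ =
  same-models-≡μ ((φ₁ ∨ φ₂) ⊕) ((φ₁ ⊕) ∨ (φ₂ ⊕)) (λ I → mk⇔ (∨-to I) (∨-from I)) ,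
  λ disjoint → same-models-≡μ ((φ₁ ∧ φ₂) ⊕) ((φ₁ ⊕) ∧ (φ₂ ⊕)) (λ I → mk⇔ (∧-to disjoint I) (∧-from disjoint I))
  where
  open Positivation P
  closure : ∀ φ (I : Structure M) → (I ⊨ (φ ⊕)) ⇔ Above φ I
  closure φ = positive-upward-closure φ (φ ⊕) (positive φ) (equiv φ)

  ∨-to : ∀ I → I ⊨ ((φ₁ ∨ φ₂) ⊕) → I ⊨ ((φ₁ ⊕) ∨ (φ₂ ⊕))
  ∨-to I sat (¬sat₁ , ¬sat₂) = to (above-∨ φ₁ φ₂ I) (to (closure _ I) sat)
    ((λ a → ¬sat₁ (from (closure φ₁ I) a)) , (λ a → ¬sat₂ (from (closure φ₂ I) a)))
  ∨-from : ∀ I → I ⊨ ((φ₁ ⊕) ∨ (φ₂ ⊕)) → I ⊨ ((φ₁ ∨ φ₂) ⊕)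
  ∨-from I sat = from (closure _ I) (from (above-∨ φ₁ φ₂ I) λ (¬a₁ , ¬a₂) →
    sat ((λ s → ¬a₁ (to (closure φ₁ I) s)) , (λ s → ¬a₂ (to (closure φ₂ I) s))))

  ∧-to : DisjointVoc φ₁ φ₂ → ∀ I → I ⊨ ((φ₁ ∧ φ₂) ⊕) → I ⊨ ((φ₁ ⊕) ∧ (φ₂ ⊕))
  ∧-to disjoint I sat with to (above-∧ φ₁ φ₂ disjoint I) (to (closure _ I) sat)
  ... | a₁ , a₂ = from (closure φ₁ I) a₁ , from (closure φ₂ I) a₂
  ∧-from : DisjointVoc φ₁ φ₂ → ∀ I → I ⊨ ((φ₁ ⊕) ∧ (φ₂ ⊕)) → I ⊨ ((φ₁ ∧ φ₂) ⊕)
  ∧-from disjoint I (s₁ , s₂) =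
    from (closure _ I) (from (above-∧ φ₁ φ₂ disjoint I) (to (closure φ₁ I) s₁ , to (closure φ₂ I) s₂))
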